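{- The monoid $R_n^0$ is $\mathcal{R}$-trivial, $\mathcal{L}$-trivial, and hence $\mathcal{J}$-trivial.
   Context: $R_n^0$ is the monoid presented by generators $\pi_0,\dots,\pi_{n-1}$ and relations $\pi_i^2=\pi_i$ ($0\le i\le n-1$), $\pi_i\pi_{i+1}\pi_i=\pi_{i+1}\pi_i\pi_{i+1}$ ($1\le i\le n-2$), $\pi_1\pi_0\pi_1\pi_0=\pi_0\pi_1\pi_0=\pi_0\pi_1\pi_0\pi_1$, $\pi_i\pi_j=\pi_j\pi_i$ ($0\le i,j\le n-1$, $|i-j|\ge2$). A monoid $M$ is $\mathcal{R}$-trivial (resp. $\mathcal{L}$-trivial, $\mathcal{J}$-trivial) if $xM=yM$ (resp. $Mx=My$, $MxM=MyM$) implies $x=y$. -}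

module Defs where

open import Level using (0ℓ)
open import Data.Nat using (ℕ; zero; suc; _≤_; ∣_-_∣)
open import Data.Fin using (Fin; toℕ)
open import Data.List using (List; []; _∷_; _++_)
open import Data.List.Properties using (++-assoc; ++-identityʳ)
open import Data.Product using (_×_; ∃; ∃₂)
open import Relation.Binary.PropositionalEquality as P using (_≡_)
open import Relation.Binary.Structures using (IsEquivalence)
open import Algebra.Bundles using (Monoid)
open import Algebra.Structures using (IsMonoid)

module _ {c ℓ} (M : Monoid c ℓ) where
  open Monoid M

  SameRightIdeal : Carrier → Carrier → Set (c Level.⊔ ℓ)
  SameRightIdeal x y = (∃ λ u → x ≈ y ∙ u) × (∃ λ v → y ≈ x ∙ v)

  SameLeftIdeal : Carrier → Carrier → Set (c Level.⊔ ℓ)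
  SameLeftIdeal x y = (∃ λ u → x ≈ u ∙ y) × (∃ λ v → y ≈ v ∙ x)

  SameTwoSidedIdeal : Carrier → Carrier → Set (c Level.⊔ ℓ)
  SameTwoSidedIdeal x y =
    (∃₂ λ a b → x ≈ (a ∙ y) ∙ b) × (∃₂ λ a b → y ≈ (a ∙ x) ∙ b)

  R-trivial : Set (c Level.⊔ ℓ)
  R-trivial = ∀ x y → SameRightIdeal x y → x ≈ y

  L-trivial : Set (c Level.⊔ ℓ)
  L-trivial = ∀ x y → SameLeftIdeal x y → x ≈ y

  J-trivial : Set (c Level.⊔ ℓ)
  J-trivial = ∀ x y → SameTwoSidedIdeal x y → x ≈ y

-- The monoid R_n^0 as a presented monoid: words over the generators
-- π_0,…,π_{n-1} (represented by Fin n) modulo the congruence generated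
-- by the defining relations.

Word : ℕ → Set
Word n = List (Fin n)

data Rule (n : ℕ) : Word n → Word n → Set where
  idem    : (i : Fin n) → Rule n (i ∷ i ∷ []) (i ∷ [])
  braid   : (i j : Fin n) → 1 ≤ toℕ i → toℕ j ≡ suc (toℕ i) →
            Rule n (i ∷ j ∷ i ∷ []) (j ∷ i ∷ j ∷ [])
  zeroˡ   : (a b : Fin n) → toℕ a ≡ 0 → toℕ b ≡ 1 →
            Rule n (b ∷ a ∷ b ∷ a ∷ []) (a ∷ b ∷ a ∷ [])
  zeroʳ   : (a b : Fin n) → toℕ a ≡ 0 → toℕ b ≡ 1 →
            Rule n (a ∷ b ∷ a ∷ []) (a ∷ b ∷ a ∷ b ∷ [])
  commute : (i j : Fin n) → 2 ≤ ∣ toℕ i - toℕ j ∣ →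
            Rule n (i ∷ j ∷ []) (j ∷ i ∷ [])

data _∼_ {n : ℕ} : Word n → Word n → Set where
  step  : (u v : Word n) {l r : Word n} → Rule n l r →
          (u ++ l ++ v) ∼ (u ++ r ++ v)
  ∼refl  : ∀ {x} → x ∼ x
  ∼sym   : ∀ {x y} → x ∼ y → y ∼ x
  ∼trans : ∀ {x y z} → x ∼ y → y ∼ z → x ∼ z

module _ {n : ℕ} where

  ≡⇒∼ : {x y : Word n} → x ≡ y → x ∼ y
  ≡⇒∼ P.refl = ∼refl

  ∼-congˡ : (w : Word n) {x y : Word n} → x ∼ y → (w ++ x) ∼ (w ++ y)
  ∼-congˡ w (step u v {l} {r} ρ) =
    ∼trans (≡⇒∼ (P.sym (++-assoc w u (l ++ v))))
      (∼trans (step (w ++ u) v ρ) (≡⇒∼ (++-assoc w u (r ++ v))))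
  ∼-congˡ w ∼refl = ∼refl
  ∼-congˡ w (∼sym p) = ∼sym (∼-congˡ w p)
  ∼-congˡ w (∼trans p q) = ∼trans (∼-congˡ w p) (∼-congˡ w q)

  assoc3 : (u l v w : Word n) → (u ++ l ++ v) ++ w ≡ u ++ l ++ (v ++ w)
  assoc3 u l v w = P.trans (++-assoc u (l ++ v) w)
                           (P.cong (u ++_) (++-assoc l v w))

  ∼-congʳ : (w : Word n) {x y : Word n} → x ∼ y → (x ++ w) ∼ (y ++ w)
  ∼-congʳ w (step u v {l} {r} ρ) =
    ∼trans (≡⇒∼ (assoc3 u l v w))
      (∼trans (step u (v ++ w) ρ) (≡⇒∼ (P.sym (assoc3 u r v w))))
  ∼-congʳ w ∼refl = ∼refl
  ∼-congʳ w (∼sym p) = ∼sym (∼-congʳ w p)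
  ∼-congʳ w (∼trans p q) = ∼trans (∼-congʳ w p) (∼-congʳ w q)

  ∼-isEquivalence : IsEquivalence (_∼_ {n})
  ∼-isEquivalence = record { refl = ∼refl ; sym = ∼sym ; trans = ∼trans }

  R⁰-isMonoid : IsMonoid (_∼_ {n}) _++_ []
  R⁰-isMonoid = record
    { isSemigroup = record
      { isMagma = record
        { isEquivalence = ∼-isEquivalence
        ; ∙-cong = λ {x} {y} {u} {v} p q →
            ∼trans (∼-congʳ u p) (∼-congˡ y q)
        }
      ; assoc = λ x y z → ≡⇒∼ (++-assoc x y z)
      }
    ; identity = (λ x → ∼refl) , (λ x → ≡⇒∼ (++-identityʳ x))
    }
    where open Data.Product using (_,_)

R⁰ : ℕ → Monoid 0ℓ 0ℓ
R⁰ n = record { isMonoid = R⁰-isMonoid {n} }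

module Submission where

-- R_n^0 acts on the right on sequences of naturals: π_0 sets the first entry
-- to 0 and π_{k+1} sorts entries k and k+1 into decreasing order. Every
-- generator moves small values to the right, so the action is monotone and
-- extensive for the dominance order that compares, on each suffix of the
-- first n positions, the number of entries at most v. The heart of the proof:
-- if π_g fixes the image ⟦ w ⟧ of the increasing sequence under a word w,
-- then w = w π_g. This is proved together with an exchange property (if π_g
-- fixes ⟦ w ⟧ strictly, then w = v π_g with π_g moving ⟦ v ⟧) by induction on
-- w, distinguishing how g sits relative to the last letter of w.
-- Now if x = p x d b, then ⟦ x d ⟧ ≼ ⟦ x d b ⟧ ≼ ⟦ p x d b ⟧ = ⟦ x ⟧ ≼ ⟦ x d ⟧,
-- so each letter of d fixes the current image and x = x d. Reversal of words
-- respects the relations, which gives x = c x symmetrically; hence the monoid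
-- is J-trivial, and R- and L-triviality follow.

open import Defs
open import Algebra.Bundles using (Monoid)
open import Data.Empty using (⊥-elim)
open import Data.Fin using (Fin; toℕ)
open import Data.Fin.Properties using (toℕ<n; toℕ-injective)
open import Data.List using ([]; _∷_; _++_; [_]; _∷ʳ_; length; reverse)
open import Data.List.Properties using (++-assoc; ++-identityʳ; reverse-++; reverse-involutive; length-++)
open import Data.List.Reverse using ([]; _∶_∶ʳ_; reverseView)
open import Data.Nat using (ℕ; zero; suc; _+_; _⊔_; _⊓_; _≤_; _<_; z≤n; s≤s; ∣_-_∣)
open import Data.Nat.Properties
open import Data.Product using (_×_; _,_; proj₁; proj₂)
open import Data.Sum using (_⊎_; inj₁; inj₂)
open import Data.Unit using (⊤; tt)
open import Function using (_∘_)
open import Relation.Nullary using (¬_; yes; no)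
open import Relation.Binary.PropositionalEquality
  using (_≡_; _≢_; _≗_; refl; sym; trans; cong; cong₂; cong-app; subst; subst₂; module ≡-Reasoning)

Seq : Set
Seq = ℕ → ℕ

sortAt : ℕ → Seq → Seq
sortAt zero    s zero          = s 0 ⊔ s 1
sortAt zero    s (suc zero)    = s 0 ⊓ s 1
sortAt zero    s (suc (suc p)) = s (suc (suc p))
sortAt (suc k) s zero          = s zero
sortAt (suc k) s (suc p)       = sortAt k (s ∘ suc) p

clearHead : Seq → Seq
clearHead s zero    = 0
clearHead s (suc p) = s (suc p)

gen : ℕ → Seq → Seq
gen zero    = clearHead
gen (suc k) = sortAt k

run : ∀ {n} → Seq → Word n → Seq
run s []      = s
run s (g ∷ w) = run (gen (toℕ g) s) w

run-++ : ∀ {n} (u v : Word n) s → run s (u ++ v) ≡ run (run s u) v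
run-++ []      v s = refl
run-++ (g ∷ u) v s = run-++ u v (gen (toℕ g) s)

sortAt-cong : ∀ k {s t} → s ≗ t → sortAt k s ≗ sortAt k t
sortAt-cong zero    s≗t zero          = cong₂ _⊔_ (s≗t 0) (s≗t 1)
sortAt-cong zero    s≗t (suc zero)    = cong₂ _⊓_ (s≗t 0) (s≗t 1)
sortAt-cong zero    s≗t (suc (suc p)) = s≗t (suc (suc p))
sortAt-cong (suc k) s≗t zero          = s≗t 0
sortAt-cong (suc k) s≗t (suc p)       = sortAt-cong k (s≗t ∘ suc) p

gen-cong : ∀ m {s t} → s ≗ t → gen m s ≗ gen m t
gen-cong zero    s≗t zero    = refl
gen-cong zero    s≗t (suc p) = s≗t (suc p)
gen-cong (suc k) s≗t         = sortAt-cong k s≗t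

run-cong : ∀ {n} (w : Word n) {s t} → s ≗ t → run s w ≗ run t w
run-cong []      s≗t = s≗t
run-cong (g ∷ w) s≗t = run-cong w (gen-cong (toℕ g) s≗t)

-- Soundness of the action

braid-max : ∀ a b c → (a ⊔ b) ⊔ ((a ⊓ b) ⊔ c) ≡ a ⊔ (b ⊔ c)
braid-max a b c = begin
  (a ⊔ b) ⊔ ((a ⊓ b) ⊔ c)  ≡⟨ ⊔-assoc (a ⊔ b) (a ⊓ b) c ⟨
  ((a ⊔ b) ⊔ (a ⊓ b)) ⊔ c  ≡⟨ cong (_⊔ c) (m≥n⇒m⊔n≡m (m⊓n≤m⊔n a b)) ⟩
  (a ⊔ b) ⊔ c              ≡⟨ ⊔-assoc a b c ⟩
  a ⊔ (b ⊔ c)              ∎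
  where open ≡-Reasoning

braid-median : ∀ a b c → (a ⊔ b) ⊓ ((a ⊓ b) ⊔ c) ≡ (a ⊓ (b ⊔ c)) ⊔ (b ⊓ c)
braid-median a b c = begin
  (a ⊔ b) ⊓ ((a ⊓ b) ⊔ c)              ≡⟨ ⊓-distribˡ-⊔ (a ⊔ b) (a ⊓ b) c ⟩
  ((a ⊔ b) ⊓ (a ⊓ b)) ⊔ ((a ⊔ b) ⊓ c)  ≡⟨ cong₂ _⊔_ (m≥n⇒m⊓n≡n (m⊓n≤m⊔n a b)) (⊓-distribʳ-⊔ c a b) ⟩
  (a ⊓ b) ⊔ ((a ⊓ c) ⊔ (b ⊓ c))        ≡⟨ ⊔-assoc (a ⊓ b) (a ⊓ c) (b ⊓ c) ⟨
  ((a ⊓ b) ⊔ (a ⊓ c)) ⊔ (b ⊓ c)        ≡⟨ cong (_⊔ (b ⊓ c)) (⊓-distribˡ-⊔ a b c) ⟨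
  (a ⊓ (b ⊔ c)) ⊔ (b ⊓ c)              ∎
  where open ≡-Reasoning

braid-min : ∀ a b c → (a ⊓ b) ⊓ c ≡ (a ⊓ (b ⊔ c)) ⊓ (b ⊓ c)
braid-min a b c = begin
  (a ⊓ b) ⊓ c              ≡⟨ ⊓-assoc a b c ⟩
  a ⊓ (b ⊓ c)              ≡⟨ cong (a ⊓_) (m≥n⇒m⊓n≡n (m⊓n≤m⊔n b c)) ⟨
  a ⊓ ((b ⊔ c) ⊓ (b ⊓ c))  ≡⟨ ⊓-assoc a (b ⊔ c) (b ⊓ c) ⟨
  (a ⊓ (b ⊔ c)) ⊓ (b ⊓ c)  ∎
  where open ≡-Reasoning

sortAt-idem : ∀ k s → sortAt k (sortAt k s) ≗ sortAt k s
sortAt-idem zero    s zero          = m≥n⇒m⊔n≡m (m⊓n≤m⊔n (s 0) (s 1))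
sortAt-idem zero    s (suc zero)    = m≥n⇒m⊓n≡n (m⊓n≤m⊔n (s 0) (s 1))
sortAt-idem zero    s (suc (suc p)) = refl
sortAt-idem (suc k) s zero          = refl
sortAt-idem (suc k) s (suc p)       = sortAt-idem k (s ∘ suc) p

sortAt-braid : ∀ k s → sortAt k (sortAt (suc k) (sortAt k s)) ≗ sortAt (suc k) (sortAt k (sortAt (suc k) s))
sortAt-braid zero    s zero                = braid-max (s 0) (s 1) (s 2)
sortAt-braid zero    s (suc zero)          = braid-median (s 0) (s 1) (s 2)
sortAt-braid zero    s (suc (suc zero))    = braid-min (s 0) (s 1) (s 2)
sortAt-braid zero    s (suc (suc (suc p))) = refl
sortAt-braid (suc k) s zero                = refl
sortAt-braid (suc k) s (suc p)             = sortAt-braid k (s ∘ suc) p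

sortAt-commute : ∀ a b → 2 ≤ ∣ a - b ∣ → ∀ s → sortAt b (sortAt a s) ≗ sortAt a (sortAt b s)
sortAt-commute zero          (suc (suc b)) _ s zero          = refl
sortAt-commute zero          (suc (suc b)) _ s (suc zero)    = refl
sortAt-commute zero          (suc (suc b)) _ s (suc (suc p)) = refl
sortAt-commute (suc (suc a)) zero          _ s zero          = refl
sortAt-commute (suc (suc a)) zero          _ s (suc zero)    = refl
sortAt-commute (suc (suc a)) zero          _ s (suc (suc p)) = refl
sortAt-commute (suc a)       (suc b)       d s zero          = refl
sortAt-commute (suc a)       (suc b)       d s (suc p)       = sortAt-commute a b d (s ∘ suc) p
sortAt-commute zero          (suc zero)    (s≤s ())
sortAt-commute (suc zero)    zero          (s≤s ())

gen-idem : ∀ m s → gen m (gen m s) ≗ gen m s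
gen-idem zero    s zero    = refl
gen-idem zero    s (suc p) = refl
gen-idem (suc k) s         = sortAt-idem k s

gen-braid : ∀ m → 1 ≤ m → ∀ s → gen m (gen (suc m) (gen m s)) ≗ gen (suc m) (gen m (gen (suc m) s))
gen-braid (suc k) _ = sortAt-braid k

gen-commute : ∀ a b → 2 ≤ ∣ a - b ∣ → ∀ s → gen b (gen a s) ≗ gen a (gen b s)
gen-commute zero          (suc (suc b)) _ s zero    = refl
gen-commute zero          (suc (suc b)) _ s (suc p) = refl
gen-commute (suc (suc a)) zero          _ s zero    = refl
gen-commute (suc (suc a)) zero          _ s (suc p) = refl
gen-commute (suc a)       (suc b)       d           = sortAt-commute a b d
gen-commute zero          (suc zero)    (s≤s ())
gen-commute (suc zero)    zero          (s≤s ())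

gen-zeroˡ : ∀ s → clearHead (sortAt 0 (clearHead (sortAt 0 s))) ≗ clearHead (sortAt 0 (clearHead s))
gen-zeroˡ s zero          = refl
gen-zeroˡ s (suc zero)    = refl
gen-zeroˡ s (suc (suc p)) = refl

gen-zeroʳ : ∀ s → clearHead (sortAt 0 (clearHead s)) ≗ sortAt 0 (clearHead (sortAt 0 (clearHead s)))
gen-zeroʳ s zero          = refl
gen-zeroʳ s (suc zero)    = refl
gen-zeroʳ s (suc (suc p)) = refl

rule-sound : ∀ {n l r} → Rule n l r → ∀ s → run s l ≗ run s r
rule-sound (idem i)              s = gen-idem (toℕ i) s
rule-sound (braid i j 1≤i j≡1+i) s rewrite j≡1+i = gen-braid (toℕ i) 1≤i s
rule-sound (zeroˡ a b a≡0 b≡1)   s rewrite a≡0 | b≡1 = gen-zeroˡ s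
rule-sound (zeroʳ a b a≡0 b≡1)   s rewrite a≡0 | b≡1 = gen-zeroʳ s
rule-sound (commute i j d)       s = gen-commute (toℕ i) (toℕ j) d s

∼-sound : ∀ {n} {x y : Word n} → x ∼ y → ∀ s → run s x ≗ run s y
∼-sound (step u v {l} {r} ρ) s p = begin
  run s (u ++ l ++ v) p      ≡⟨ cong-app (run-++ u (l ++ v) s) p ⟩
  run (run s u) (l ++ v) p   ≡⟨ cong-app (run-++ l v (run s u)) p ⟩
  run (run (run s u) l) v p  ≡⟨ run-cong v (rule-sound ρ (run s u)) p ⟩
  run (run (run s u) r) v p  ≡⟨ cong-app (run-++ r v (run s u)) p ⟨
  run (run s u) (r ++ v) p   ≡⟨ cong-app (run-++ u (r ++ v) s) p ⟨
  run s (u ++ r ++ v) p      ∎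
  where open ≡-Reasoning
∼-sound ∼refl        s p = refl
∼-sound (∼sym x∼y)   s p = sym (∼-sound x∼y s p)
∼-sound (∼trans x∼y y∼z) s p = trans (∼-sound x∼y s p) (∼-sound y∼z s p)

-- The dominance order

atMost : ℕ → ℕ → ℕ
atMost zero    v       = 1
atMost (suc a) zero    = 0
atMost (suc a) (suc v) = atMost a v

atMost≤1 : ∀ a v → atMost a v ≤ 1
atMost≤1 zero    v       = ≤-refl
atMost≤1 (suc a) zero    = z≤n
atMost≤1 (suc a) (suc v) = atMost≤1 a v

atMost-⊓ : ∀ a b v → atMost (a ⊓ b) v ≡ atMost a v ⊔ atMost b v
atMost-⊓ zero    b       v       = sym (m≥n⇒m⊔n≡m (atMost≤1 b v))
atMost-⊓ (suc a) zero    v       = sym (m≤n⇒m⊔n≡n (atMost≤1 (suc a) v))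
atMost-⊓ (suc a) (suc b) zero    = refl
atMost-⊓ (suc a) (suc b) (suc v) = atMost-⊓ a b v

atMost-⊔-⊓ : ∀ a b v → atMost (a ⊔ b) v + atMost (a ⊓ b) v ≡ atMost a v + atMost b v
atMost-⊔-⊓ zero    b       v       = +-comm (atMost b v) 1
atMost-⊔-⊓ (suc a) zero    v       = refl
atMost-⊔-⊓ (suc a) (suc b) zero    = refl
atMost-⊔-⊓ (suc a) (suc b) (suc v) = atMost-⊔-⊓ a b v

atMost-self : ∀ a → atMost a a ≡ 1
atMost-self zero    = refl
atMost-self (suc a) = atMost-self a

atMost≡1⇒≤ : ∀ a v → atMost a v ≡ 1 → a ≤ v
atMost≡1⇒≤ zero    v       _  = z≤n
atMost≡1⇒≤ (suc a) (suc v) eq = s≤s (atMost≡1⇒≤ a v eq)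

atMost-injective : ∀ a b → (∀ v → atMost a v ≡ atMost b v) → a ≡ b
atMost-injective a b eq = ≤-antisym
  (atMost≡1⇒≤ a b (trans (eq b) (atMost-self b)))
  (atMost≡1⇒≤ b a (trans (sym (eq a)) (atMost-self a)))

count : ℕ → ℕ → Seq → ℕ
count zero    v s = 0
count (suc m) v s = atMost (s 0) v + count m v (s ∘ suc)

_≼[_]_ : Seq → ℕ → Seq → Set
s ≼[ zero  ] t = ⊤
s ≼[ suc m ] t = (∀ v → count (suc m) v s ≤ count (suc m) v t) × (s ∘ suc) ≼[ m ] (t ∘ suc)

count-cong : ∀ m v {s t} → s ≗ t → count m v s ≡ count m v t
count-cong zero    v s≗t = refl
count-cong (suc m) v s≗t = cong₂ _+_ (cong (λ a → atMost a v) (s≗t 0)) (count-cong m v (s≗t ∘ suc))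

≼-resp-≗ : ∀ m {s s′ t t′} → s ≗ s′ → t ≗ t′ → s ≼[ m ] t → s′ ≼[ m ] t′
≼-resp-≗ zero    _    _    _               = tt
≼-resp-≗ (suc m) s≗s′ t≗t′ (counts , rest) =
  (λ v → subst₂ _≤_ (count-cong (suc m) v s≗s′) (count-cong (suc m) v t≗t′) (counts v)) ,
  ≼-resp-≗ m (s≗s′ ∘ suc) (t≗t′ ∘ suc) rest

≼-refl : ∀ m s → s ≼[ m ] s
≼-refl zero    s = tt
≼-refl (suc m) s = (λ v → ≤-refl) , ≼-refl m (s ∘ suc)

≼-trans : ∀ m {s t u} → s ≼[ m ] t → t ≼[ m ] u → s ≼[ m ] u
≼-trans zero    _               _                 = tt
≼-trans (suc m) (counts , rest) (counts′ , rest′) =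
  (λ v → ≤-trans (counts v) (counts′ v)) , ≼-trans m rest rest′

≼⇒count≤ : ∀ m {s t} → s ≼[ m ] t → ∀ v → count m v s ≤ count m v t
≼⇒count≤ zero    _            v = z≤n
≼⇒count≤ (suc m) (counts , _) v = counts v

≼-antisym : ∀ m {s t} → s ≼[ m ] t → t ≼[ m ] s → ∀ p → p < m → s p ≡ t p
≼-antisym (suc m) {s} {t} (counts , rest) (counts′ , rest′) zero _ =
  atMost-injective (s 0) (t 0) λ v → +-cancelʳ-≡ _ _ _ (begin
    atMost (s 0) v + count m v (s ∘ suc)  ≡⟨ ≤-antisym (counts v) (counts′ v) ⟩
    atMost (t 0) v + count m v (t ∘ suc)  ≡⟨ cong (atMost (t 0) v +_) (≤-antisym (≼⇒count≤ m rest′ v)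
                                                                                (≼⇒count≤ m rest v)) ⟩
    atMost (t 0) v + count m v (s ∘ suc)  ∎)
  where open ≡-Reasoning
≼-antisym (suc m) (_ , rest) (_ , rest′) (suc p) (s≤s p<m) = ≼-antisym m rest rest′ p p<m

count-sortAt : ∀ k m v s → suc k < m → count m v (sortAt k s) ≡ count m v s
count-sortAt zero (suc (suc m)) v s _ = begin
  atMost (s 0 ⊔ s 1) v + (atMost (s 0 ⊓ s 1) v + rest)  ≡⟨ +-assoc (atMost (s 0 ⊔ s 1) v) _ rest ⟨
  atMost (s 0 ⊔ s 1) v + atMost (s 0 ⊓ s 1) v + rest    ≡⟨ cong (_+ rest) (atMost-⊔-⊓ (s 0) (s 1) v) ⟩
  atMost (s 0) v + atMost (s 1) v + rest                ≡⟨ +-assoc (atMost (s 0) v) _ rest ⟩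
  atMost (s 0) v + (atMost (s 1) v + rest)              ∎
  where
  open ≡-Reasoning
  rest = count m v (s ∘ suc ∘ suc)
count-sortAt zero (suc zero) v s (s≤s ())
count-sortAt (suc k) (suc m) v s (s≤s k<m) = cong (atMost (s 0) v +_) (count-sortAt k m v (s ∘ suc) k<m)

count-sortAt-tail : ∀ m v s → count (suc m) v (sortAt 0 s ∘ suc) ≡
                                atMost (s 0) v ⊔ atMost (s 1) v + count m v (s ∘ suc ∘ suc)
count-sortAt-tail m v s = cong (_+ count m v (s ∘ suc ∘ suc)) (atMost-⊓ (s 0) (s 1) v)

count-sortAt-mono : ∀ k m {s t} → suc k < m → (∀ v → count m v s ≤ count m v t) →
                    ∀ v → count m v (sortAt k s) ≤ count m v (sortAt k t)
count-sortAt-mono k m {s} {t} k<m counts v =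
  subst₂ _≤_ (sym (count-sortAt k m v s k<m)) (sym (count-sortAt k m v t k<m)) (counts v)

⊔-+-mono-≤ : ∀ a b a′ b′ {x x′} → a ⊔ b ≤ 1 → x ≤ x′ →
             a + (b + x) ≤ a′ + (b′ + x′) → a ⊔ b + x ≤ a′ ⊔ b′ + x′
⊔-+-mono-≤ a b zero zero {x} {x′} _ _ ab+x≤x′ = begin
  a ⊔ b + x    ≤⟨ +-monoˡ-≤ x (m⊔n≤m+n a b) ⟩
  a + b + x    ≡⟨ +-assoc a b x ⟩
  a + (b + x)  ≤⟨ ab+x≤x′ ⟩
  x′           ∎
  where open ≤-Reasoning
⊔-+-mono-≤ _ _ (suc a′) b′ a⊔b≤1 x≤x′ _ =
  +-mono-≤ (≤-trans a⊔b≤1 (≤-trans (s≤s z≤n) (m≤m⊔n (suc a′) b′))) x≤x′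
⊔-+-mono-≤ _ _ zero (suc b′) a⊔b≤1 x≤x′ _ = +-mono-≤ (≤-trans a⊔b≤1 (s≤s z≤n)) x≤x′

sortAt-monotone : ∀ k m {s t} → suc k < m → s ≼[ m ] t → sortAt k s ≼[ m ] sortAt k t
sortAt-monotone zero (suc (suc m)) {s} {t} k<m (counts , _ , rest) =
  count-sortAt-mono 0 (suc (suc m)) {s} {t} k<m counts , tail-counts , rest
  where
  tail-counts : ∀ v → count (suc m) v (sortAt 0 s ∘ suc) ≤ count (suc m) v (sortAt 0 t ∘ suc)
  tail-counts v = subst₂ _≤_ (sym (count-sortAt-tail m v s)) (sym (count-sortAt-tail m v t))
    (⊔-+-mono-≤ (atMost (s 0) v) (atMost (s 1) v) (atMost (t 0) v) (atMost (t 1) v)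
                (⊔-lub (atMost≤1 (s 0) v) (atMost≤1 (s 1) v)) (≼⇒count≤ m rest v) (counts v))
sortAt-monotone zero (suc zero) (s≤s ())
sortAt-monotone (suc k) (suc m) {s} {t} k<m (counts , rest) =
  count-sortAt-mono (suc k) (suc m) {s} {t} k<m counts , sortAt-monotone k m (≤-pred k<m) rest

sortAt-extensive : ∀ k m s → suc k < m → s ≼[ m ] sortAt k s
sortAt-extensive zero (suc (suc m)) s k<m =
  (λ v → ≤-reflexive (sym (count-sortAt 0 _ v s k<m))) ,
  (λ v → subst (atMost (s 1) v + count m v (s ∘ suc ∘ suc) ≤_) (sym (count-sortAt-tail m v s))
               (+-monoˡ-≤ _ (m≤n⊔m (atMost (s 0) v) (atMost (s 1) v)))) ,
  ≼-refl m (s ∘ suc ∘ suc)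
sortAt-extensive zero (suc zero) s (s≤s ())
sortAt-extensive (suc k) (suc m) s k<m =
  (λ v → ≤-reflexive (sym (count-sortAt (suc k) _ v s k<m))) , sortAt-extensive k m (s ∘ suc) (≤-pred k<m)

gen-monotone : ∀ {n} (g : Fin n) {s t} → s ≼[ n ] t → gen (toℕ g) s ≼[ n ] gen (toℕ g) t
gen-monotone {suc m} g (counts , rest) with toℕ g | toℕ<n g
... | zero  | _   = (λ v → s≤s (≼⇒count≤ m rest v)) , rest
... | suc k | k<n = sortAt-monotone k (suc m) k<n (counts , rest)

gen-extensive : ∀ {n} (g : Fin n) s → s ≼[ n ] gen (toℕ g) s
gen-extensive {suc m} g s with toℕ g | toℕ<n g
... | zero  | _   = (λ v → +-monoˡ-≤ (count m v (s ∘ suc)) (atMost≤1 (s 0) v)) , ≼-refl m (s ∘ suc)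
... | suc k | k<n = sortAt-extensive k (suc m) s k<n

run-monotone : ∀ {n} (w : Word n) {s t} → s ≼[ n ] t → run s w ≼[ n ] run t w
run-monotone []      s≼t = s≼t
run-monotone (g ∷ w) s≼t = run-monotone w (gen-monotone g s≼t)

run-extensive : ∀ {n} (w : Word n) s → s ≼[ n ] run s w
run-extensive []      s = ≼-refl _ s
run-extensive (g ∷ w) s = ≼-trans _ (gen-extensive g s) (run-extensive w (gen (toℕ g) s))

-- Fixed points of generators

sortAt-max : ∀ k s → sortAt k s k ≡ s k ⊔ s (suc k)
sortAt-max zero    s = refl
sortAt-max (suc k) s = sortAt-max k (s ∘ suc)

sortAt-min : ∀ k s → sortAt k s (suc k) ≡ s k ⊓ s (suc k)
sortAt-min zero    s = refl
sortAt-min (suc k) s = sortAt-min k (s ∘ suc)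

sortAt-below : ∀ k s → sortAt (suc k) s k ≡ s k
sortAt-below zero    s = refl
sortAt-below (suc k) s = sortAt-below k (s ∘ suc)

sortAt-above : ∀ k s → sortAt k s (suc (suc k)) ≡ s (suc (suc k))
sortAt-above zero    s = refl
sortAt-above (suc k) s = sortAt-above k (s ∘ suc)

-- The entries read by π_m; the second component is a dummy for m = 0.
window : ℕ → Seq → ℕ × ℕ
window zero    s = s 0 , 0
window (suc k) s = s k , s (suc k)

FixesW StrictlyFixesW MovesW : ℕ → ℕ × ℕ → Set
FixesW zero    (a , _) = a ≡ 0
FixesW (suc k) (a , b) = b ≤ a
StrictlyFixesW zero    (a , _) = a ≡ 0
StrictlyFixesW (suc k) (a , b) = b < a
MovesW zero    (a , _) = a ≢ 0
MovesW (suc k) (a , b) = a < b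

Fixed StrictlyFixed Moved : ℕ → Seq → Set
Fixed         m s = FixesW m (window m s)
StrictlyFixed m s = StrictlyFixesW m (window m s)
Moved         m s = MovesW m (window m s)

window-cong : ∀ m {s t} → s ≗ t → window m s ≡ window m t
window-cong zero    s≗t = cong (_, 0) (s≗t 0)
window-cong (suc k) s≗t = cong₂ _,_ (s≗t k) (s≗t (suc k))

strict⇒fixed : ∀ m s → StrictlyFixed m s → Fixed m s
strict⇒fixed zero    s s₀≡0 = s₀≡0
strict⇒fixed (suc k) s lt   = <⇒≤ lt

fixed⊎moved : ∀ m s → Fixed m s ⊎ Moved m s
fixed⊎moved zero s with s 0 ≟ 0
... | yes s₀≡0 = inj₁ s₀≡0
... | no  s₀≢0 = inj₂ s₀≢0
fixed⊎moved (suc k) s with s (suc k) ≤? s k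
... | yes le = inj₁ le
... | no  nle = inj₂ (≰⇒> nle)

fixed⇐gen-trivial : ∀ m s n → m < n → (∀ p → p < n → s p ≡ gen m s p) → Fixed m s
fixed⇐gen-trivial zero    s n 0<n    trivial = trivial 0 0<n
fixed⇐gen-trivial (suc k) s n 1+k<n trivial =
  subst (s (suc k) ≤_) (sym (trans (trivial k (<-trans (n<1+n k) 1+k<n)) (sortAt-max k s)))
        (m≤n⊔m (s k) (s (suc k)))

window-far : ∀ a b → 2 ≤ ∣ a - b ∣ → ∀ s → window a (gen b s) ≡ window a s
window-far zero                (suc (suc b))       _ s = refl
window-far (suc (suc a))       zero                _ s = refl
window-far (suc zero)          (suc (suc (suc b))) _ s = refl
window-far (suc (suc (suc a))) (suc zero)          _ s = refl
window-far (suc (suc a))       (suc (suc b))       d s = window-far (suc a) (suc b) d (s ∘ suc)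
window-far zero                (suc zero)          (s≤s ())
window-far (suc zero)          zero                (s≤s ())
window-far (suc zero)          (suc (suc zero))    (s≤s ())
window-far (suc (suc zero))    (suc zero)          (s≤s ())

ascending : Seq
ascending = suc

ascending-unfixed : ∀ m → ¬ Fixed m ascending
ascending-unfixed zero    ()
ascending-unfixed (suc k) le = 1+n≰n le

sortAt-moved-max : ∀ k s → Moved (suc k) s → sortAt k s k ≡ s (suc k)
sortAt-moved-max k s moved = trans (sortAt-max k s) (m≤n⇒m⊔n≡n (<⇒≤ moved))

sortAt-moved-min : ∀ k s → Moved (suc k) s → sortAt k s (suc k) ≡ s k
sortAt-moved-min k s moved = trans (sortAt-min k s) (m≤n⇒m⊓n≡m (<⇒≤ moved))

-- The exchange step for g = π_{k+1} and a last letter h = π_{k+2}: t is the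
-- image of w₀ in w = w₀ h, and t ≗ sortAt k u where u is the image of v in w₀ ∼ v g.

up-before : ∀ k t → Moved (suc (suc k)) t → Fixed (suc k) (sortAt (suc k) t) → StrictlyFixed (suc k) t
up-before k t moved fixed = <-≤-trans moved (≤-trans (m≤n⊔m _ _) fixed′)
  where
  fixed′ : t (suc k) ⊔ t (suc (suc k)) ≤ t k
  fixed′ = subst₂ _≤_ (sortAt-max (suc k) t) (sortAt-below k t) fixed

up-middle-values : ∀ k t u → t ≗ sortAt k u → Moved (suc k) u →
                   u (suc k) ≡ t k × u (suc (suc k)) ≡ t (suc (suc k))
up-middle-values k t u t≗ moved =
  sym (trans (t≗ k) (sortAt-moved-max k u moved)) , sym (trans (t≗ (suc (suc k))) (sortAt-above k u))

up-middle-fixed : ∀ k t u → t ≗ sortAt k u → Moved (suc k) u →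
                  Fixed (suc k) (sortAt (suc k) t) → Fixed (suc (suc k)) u
up-middle-fixed k t u t≗ moved fixed with up-middle-values k t u t≗ moved
... | u₁ , u₂ = subst₂ _≤_ (sym u₂) (sym u₁)
  (≤-trans (m≤n⊔m _ _) (subst₂ _≤_ (sortAt-max (suc k) t) (sortAt-below k t) fixed))

up-middle-strict : ∀ k t u → t ≗ sortAt k u → Moved (suc k) u →
                   StrictlyFixed (suc k) (sortAt (suc k) t) → StrictlyFixed (suc (suc k)) u
up-middle-strict k t u t≗ moved strict with up-middle-values k t u t≗ moved
... | u₁ , u₂ = subst₂ _<_ (sym u₂) (sym u₁)
  (≤-<-trans (m≤n⊔m _ _) (subst₂ _<_ (sortAt-max (suc k) t) (sortAt-below k t) strict))

up-end : ∀ k t u u₂ → t ≗ sortAt k u → u ≗ sortAt (suc k) u₂ → Moved (suc k) u →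
         Moved (suc (suc k)) u₂ → Moved (suc (suc k)) t → StrictlyFixed (suc k) (sortAt (suc k) t) →
         Moved (suc k) (sortAt (suc k) (sortAt k u₂))
up-end k t u u₂ t≗ u≗ moved moved₂ t-moved strict = begin-strict
  sortAt (suc k) (sortAt k u₂) k   ≡⟨ sortAt-below k (sortAt k u₂) ⟩
  sortAt k u₂ k                    ≡⟨ sortAt-moved-max k u₂ u₂-moved ⟩
  u₂ (suc k)                       ≡⟨ u₂-middle ⟩
  t (suc (suc k))                  <⟨ ≤-<-trans (m≤n⊔m _ _) strict′ ⟩
  t k                              ≡⟨ proj₁ (up-middle-values k t u t≗ moved) ⟨
  u (suc k)                        ≡⟨ trans (u≗ (suc k)) (sortAt-moved-max (suc k) u₂ moved₂) ⟩
  u₂ (suc (suc k))                 ≡⟨ sortAt-above k u₂ ⟨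
  sortAt k u₂ (suc (suc k))        ≤⟨ m≤n⊔m _ _ ⟩
  sortAt k u₂ (suc k) ⊔ sortAt k u₂ (suc (suc k))  ≡⟨ sortAt-max (suc k) (sortAt k u₂) ⟨
  sortAt (suc k) (sortAt k u₂) (suc k)             ∎
  where
  open ≤-Reasoning hiding (strict)
  strict′ : t (suc k) ⊔ t (suc (suc k)) < t k
  strict′ = subst₂ _<_ (sortAt-max (suc k) t) (sortAt-below k t) strict
  u₂-middle : u₂ (suc k) ≡ t (suc (suc k))
  u₂-middle = trans (sym (trans (u≗ (suc (suc k))) (sortAt-moved-min (suc k) u₂ moved₂)))
                    (proj₂ (up-middle-values k t u t≗ moved))
  u₂-moved : Moved (suc k) u₂
  u₂-moved = subst₂ _<_
    (trans (trans (t≗ (suc k)) (sortAt-moved-min k u moved)) (trans (u≗ k) (sortAt-below k u₂)))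
    (sym u₂-middle) t-moved

-- The same for g = π_{k+2} and h = π_{k+1}, where t ≗ sortAt (suc k) u.

down-before : ∀ k t → Moved (suc k) t → Fixed (suc (suc k)) (sortAt k t) → StrictlyFixed (suc (suc k)) t
down-before k t moved fixed = ≤-<-trans (≤-trans fixed′ (m⊓n≤m _ _)) moved
  where
  fixed′ : t (suc (suc k)) ≤ t k ⊓ t (suc k)
  fixed′ = subst₂ _≤_ (sortAt-above k t) (sortAt-min k t) fixed

down-middle-values : ∀ k t u → t ≗ sortAt (suc k) u → Moved (suc (suc k)) u →
                     u k ≡ t k × u (suc k) ≡ t (suc (suc k))
down-middle-values k t u t≗ moved =
  sym (trans (t≗ k) (sortAt-below k u)) , sym (trans (t≗ (suc (suc k))) (sortAt-moved-min (suc k) u moved))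

down-middle-fixed : ∀ k t u → t ≗ sortAt (suc k) u → Moved (suc (suc k)) u →
                    Fixed (suc (suc k)) (sortAt k t) → Fixed (suc k) u
down-middle-fixed k t u t≗ moved fixed with down-middle-values k t u t≗ moved
... | u₀ , u₁ = subst₂ _≤_ (sym u₁) (sym u₀)
  (≤-trans (subst₂ _≤_ (sortAt-above k t) (sortAt-min k t) fixed) (m⊓n≤m _ _))

down-middle-strict : ∀ k t u → t ≗ sortAt (suc k) u → Moved (suc (suc k)) u →
                     StrictlyFixed (suc (suc k)) (sortAt k t) → StrictlyFixed (suc k) u
down-middle-strict k t u t≗ moved strict with down-middle-values k t u t≗ moved
... | u₀ , u₁ = subst₂ _<_ (sym u₁) (sym u₀)
  (<-≤-trans (subst₂ _<_ (sortAt-above k t) (sortAt-min k t) strict) (m⊓n≤m _ _))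

down-end : ∀ k t u u₂ → t ≗ sortAt (suc k) u → u ≗ sortAt k u₂ → Moved (suc (suc k)) u →
           Moved (suc k) u₂ → Moved (suc k) t → StrictlyFixed (suc (suc k)) (sortAt k t) →
           Moved (suc (suc k)) (sortAt k (sortAt (suc k) u₂))
down-end k t u u₂ t≗ u≗ moved moved₂ t-moved strict = begin-strict
  sortAt k (sortAt (suc k) u₂) (suc k)  ≡⟨ sortAt-min k (sortAt (suc k) u₂) ⟩
  sortAt (suc k) u₂ k ⊓ sortAt (suc k) u₂ (suc k)  ≤⟨ m⊓n≤m _ _ ⟩
  sortAt (suc k) u₂ k                   ≡⟨ sortAt-below k u₂ ⟩
  u₂ k                                  ≡⟨ sortAt-moved-min k u₂ moved₂ ⟨
  sortAt k u₂ (suc k)                   ≡⟨ u≗ (suc k) ⟨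
  u (suc k)                             ≡⟨ proj₂ (down-middle-values k t u t≗ moved) ⟩
  t (suc (suc k))                       <⟨ ⊓-glb c<a c<b ⟩
  u₂ (suc k) ⊓ u₂ (suc (suc k))         ≡⟨ sortAt-min (suc k) u₂ ⟨
  sortAt (suc k) u₂ (suc (suc k))       ≡⟨ sortAt-above k (sortAt (suc k) u₂) ⟨
  sortAt k (sortAt (suc k) u₂) (suc (suc k))  ∎
  where
  open ≤-Reasoning hiding (strict)
  strict′ : t (suc (suc k)) < t k ⊓ t (suc k)
  strict′ = subst₂ _<_ (sortAt-above k t) (sortAt-min k t) strict
  u₂-middle : u₂ (suc k) ≡ t k
  u₂-middle = trans (sym (trans (u≗ k) (sortAt-moved-max k u₂ moved₂))) (proj₁ (down-middle-values k t u t≗ moved))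
  u₂-top : u₂ (suc (suc k)) ≡ t (suc k)
  u₂-top = trans (sym (trans (u≗ (suc (suc k))) (sortAt-above k u₂)))
                 (sym (trans (t≗ (suc k)) (sortAt-moved-max (suc k) u moved)))
  c<a : t (suc (suc k)) < u₂ (suc k)
  c<a = subst (t (suc (suc k)) <_) (sym u₂-middle) (<-≤-trans strict′ (m⊓n≤m _ _))
  c<b : t (suc (suc k)) < u₂ (suc (suc k))
  c<b = subst (t (suc (suc k)) <_) (sym u₂-top) (<-trans (<-≤-trans strict′ (m⊓n≤m _ _)) t-moved)

one-zero-before : ∀ t → Moved 0 t → Fixed 1 (clearHead t) → StrictlyFixed 1 t
one-zero-before t t₀≢0 t₁≤0 = subst (_< t 0) (sym (n≤0⇒n≡0 t₁≤0)) (n≢0⇒n>0 t₀≢0)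

one-zero-middle : ∀ t u → t ≗ sortAt 0 u → Moved 1 u → Fixed 1 (clearHead t) → Fixed 0 u
one-zero-middle t u t≗ moved t₁≤0 = trans (sym (trans (t≗ 1) (sortAt-moved-min 0 u moved))) (n≤0⇒n≡0 t₁≤0)

zero-one-unfixed : ∀ t → Moved 1 t → ¬ Fixed 0 (sortAt 0 t)
zero-one-unfixed t t₀<t₁ t₀⊔t₁≡0 = n≮0 (<-≤-trans t₀<t₁ (subst (t 1 ≤_) t₀⊔t₁≡0 (m≤n⊔m (t 0) (t 1))))

data Adjacency : ℕ → ℕ → Set where
  same     : ∀ {a} → Adjacency a a
  far      : ∀ {a b} → 2 ≤ ∣ a - b ∣ → Adjacency a b
  up       : ∀ k → Adjacency (suc k) (suc (suc k))
  down     : ∀ k → Adjacency (suc (suc k)) (suc k)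
  one-zero : Adjacency 1 0
  zero-one : Adjacency 0 1

adjacency-suc : ∀ {a b} → Adjacency a b → Adjacency (suc a) (suc b)
adjacency-suc same     = same
adjacency-suc (far d)  = far d
adjacency-suc (up k)   = up (suc k)
adjacency-suc (down k) = down (suc k)
adjacency-suc one-zero = down 0
adjacency-suc zero-one = up 0

adjacency : ∀ a b → Adjacency a b
adjacency zero          zero          = same
adjacency zero          (suc zero)    = zero-one
adjacency zero          (suc (suc b)) = far (s≤s (s≤s z≤n))
adjacency (suc zero)    zero          = one-zero
adjacency (suc (suc a)) zero          = far (s≤s (s≤s z≤n))
adjacency (suc a)       (suc b)       = adjacency-suc (adjacency a b)

-- Absorption of letters

module _ {n : ℕ} where

  open import Relation.Binary.Reasoning.Setoid (Monoid.setoid (R⁰ n)) as ∼-Reasoning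

  ⟦_⟧ : Word n → Seq
  ⟦ w ⟧ = run ascending w

  ⟦⟧-sound : {w w′ : Word n} → w ∼ w′ → ⟦ w ⟧ ≗ ⟦ w′ ⟧
  ⟦⟧-sound w∼w′ = ∼-sound w∼w′ ascending

  ⟦⟧-∷ʳ : ∀ (w : Word n) g → ⟦ w ∷ʳ g ⟧ ≡ gen (toℕ g) ⟦ w ⟧
  ⟦⟧-∷ʳ w g = run-++ w [ g ] ascending

  ⟦⟧-factor : ∀ {w v : Word n} {g m} → w ∼ (v ∷ʳ g) → toℕ g ≡ m → ⟦ w ⟧ ≗ gen m ⟦ v ⟧
  ⟦⟧-factor {v = v} {g} w∼vg refl p = trans (⟦⟧-sound w∼vg p) (cong-app (⟦⟧-∷ʳ v g) p)

  ⟦⟧-pair : ∀ (v : Word n) g h {a b} → toℕ g ≡ a → toℕ h ≡ b → ⟦ v ++ g ∷ h ∷ [] ⟧ ≡ gen b (gen a ⟦ v ⟧)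
  ⟦⟧-pair v g h refl refl = run-++ v (g ∷ h ∷ []) ascending

  length-∷ʳ : ∀ (w : Word n) g → length (w ∷ʳ g) ≡ suc (length w)
  length-∷ʳ w g = trans (length-++ w) (+-comm (length w) 1)

  ∷ʳ-shorter : ∀ (w : Word n) h → length w < length (w ∷ʳ h)
  ∷ʳ-shorter w h = subst (length w <_) (sym (length-∷ʳ w h)) ≤-refl

  ∷ʳ-bounded : ∀ (w : Word n) h {bound} → length (w ∷ʳ h) < suc bound → length w < bound
  ∷ʳ-bounded w h len = subst (_≤ _) (length-∷ʳ w h) (≤-pred len)

  length-pair : ∀ (w : Word n) g h → length (w ++ g ∷ h ∷ []) ≡ suc (suc (length w))
  length-pair w g h = trans (length-++ w) (+-comm (length w) 2)

  apply-rule : ∀ (v : Word n) {l r} → Rule n l r → (v ++ l) ∼ (v ++ r)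
  apply-rule v {l} {r} ρ =
    subst₂ _∼_ (cong (v ++_) (++-identityʳ l)) (cong (v ++_) (++-identityʳ r)) (step v [] ρ)

  apply-braid : ∀ (v : Word n) {i j} k → toℕ i ≡ suc k → toℕ j ≡ suc (suc k) →
                (v ++ i ∷ j ∷ i ∷ []) ∼ (v ++ j ∷ i ∷ j ∷ [])
  apply-braid v k i≡ j≡ =
    apply-rule v (braid _ _ (subst (1 ≤_) (sym i≡) (s≤s z≤n)) (trans j≡ (cong suc (sym i≡))))

  ∼-∷ʳ : ∀ {w v : Word n} {g} h → w ∼ (v ∷ʳ g) → (w ∷ʳ h) ∼ (v ++ g ∷ h ∷ [])
  ∼-∷ʳ {v = v} {g} h w∼vg = ∼trans (∼-congʳ [ h ] w∼vg) (≡⇒∼ (++-assoc v [ g ] [ h ]))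

  absorb-letter : ∀ {v : Word n} {h} l → v ∼ (v ∷ʳ h) → (v ++ h ∷ l) ∼ (v ++ l)
  absorb-letter {v} {h} l v∼vh = ∼trans (≡⇒∼ (sym (++-assoc v [ h ] l))) (∼-congʳ l (∼sym v∼vh))

  absorb-via : ∀ {w₀ v : Word n} {g h} → w₀ ∼ (v ∷ʳ g) →
               (v ++ g ∷ h ∷ g ∷ []) ∼ (v ++ g ∷ h ∷ []) → (w₀ ∷ʳ h) ∼ ((w₀ ∷ʳ h) ∷ʳ g)
  absorb-via {w₀} {v} {g} {h} w₀∼vg ghg∼gh = begin
    w₀ ∷ʳ h                 ≈⟨ ∼-∷ʳ h w₀∼vg ⟩
    v ++ g ∷ h ∷ []         ≈⟨ ghg∼gh ⟨
    v ++ g ∷ h ∷ g ∷ []     ≡⟨ ++-assoc v (g ∷ h ∷ []) [ g ] ⟨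
    (v ++ g ∷ h ∷ []) ∷ʳ g  ≈⟨ ∼-congʳ [ g ] (∼-∷ʳ h w₀∼vg) ⟨
    (w₀ ∷ʳ h) ∷ʳ g          ∎

  exchange-via : ∀ {w₀ v v₂ : Word n} {g h} → w₀ ∼ (v ∷ʳ g) → v ∼ (v₂ ∷ʳ h) →
                 (v₂ ++ h ∷ g ∷ h ∷ []) ∼ (v₂ ++ g ∷ h ∷ g ∷ []) → (w₀ ∷ʳ h) ∼ ((v₂ ++ g ∷ h ∷ []) ∷ʳ g)
  exchange-via {w₀} {v} {v₂} {g} {h} w₀∼vg v∼v₂h hgh∼ghg = begin
    w₀ ∷ʳ h                     ≈⟨ ∼-∷ʳ h w₀∼vg ⟩
    v ++ g ∷ h ∷ []             ≈⟨ ∼-congʳ (g ∷ h ∷ []) v∼v₂h ⟩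
    (v₂ ∷ʳ h) ++ g ∷ h ∷ []     ≡⟨ ++-assoc v₂ [ h ] (g ∷ h ∷ []) ⟩
    v₂ ++ h ∷ g ∷ h ∷ []        ≈⟨ hgh∼ghg ⟩
    v₂ ++ g ∷ h ∷ g ∷ []        ≡⟨ ++-assoc v₂ (g ∷ h ∷ []) [ g ] ⟨
    (v₂ ++ g ∷ h ∷ []) ∷ʳ g     ∎

  pair-shorter : ∀ (w₀ v v₂ : Word n) g h → length v₂ < length v → length v < length w₀ →
                 length (v₂ ++ g ∷ h ∷ []) < length (w₀ ∷ʳ h)
  pair-shorter w₀ v v₂ g h v₂<v v<w₀ =
    subst₂ _<_ (sym (length-pair v₂ g h)) (sym (length-∷ʳ w₀ h)) (s≤s (≤-trans (s≤s v₂<v) v<w₀))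

  record Exchange (w : Word n) (g : Fin n) : Set where
    constructor exchanged
    field
      prefix  : Word n
      factor  : w ∼ (prefix ∷ʳ g)
      shorter : length prefix < length w
      moved   : Moved (toℕ g) ⟦ prefix ⟧

  -- Mutual induction on length w; the recursive calls are on shorter words
  -- that are not subterms of w, hence the fuel bound.
  exchange : ∀ bound (w : Word n) → length w < bound → ∀ g → StrictlyFixed (toℕ g) ⟦ w ⟧ → Exchange w g
  absorb   : ∀ bound (w : Word n) → length w < bound → ∀ g → Fixed (toℕ g) ⟦ w ⟧ → w ∼ (w ∷ʳ g)

  exchange-moved : ∀ bound (w₀ : Word n) → length w₀ < bound → ∀ g h {a b} → toℕ g ≡ a → toℕ h ≡ b →
                   Adjacency a b → Moved b ⟦ w₀ ⟧ → StrictlyFixed a (gen b ⟦ w₀ ⟧) → Exchange (w₀ ∷ʳ h) g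
  absorb-moved : ∀ bound (w₀ : Word n) → length w₀ < bound → ∀ g h {a b} → toℕ g ≡ a → toℕ h ≡ b →
                 Adjacency a b → Moved b ⟦ w₀ ⟧ → Fixed a (gen b ⟦ w₀ ⟧) → (w₀ ∷ʳ h) ∼ ((w₀ ∷ʳ h) ∷ʳ g)

  exchange (suc bound) w len g strict with reverseView w
  ... | [] = ⊥-elim (ascending-unfixed (toℕ g) (strict⇒fixed (toℕ g) ascending strict))
  ... | w₀ ∶ _ ∶ʳ h with fixed⊎moved (toℕ h) ⟦ w₀ ⟧
  ...   | inj₂ h-moved = exchange-moved bound w₀ (∷ʳ-bounded w₀ h len) g h refl refl (adjacency _ _) h-moved
                           (subst (StrictlyFixed (toℕ g)) (⟦⟧-∷ʳ w₀ h) strict)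
  ...   | inj₁ h-fixed =
    exchanged E.prefix (∼trans (∼sym w₀∼w₀h) E.factor) (<-trans E.shorter (∷ʳ-shorter w₀ h)) E.moved
    where
    w₀∼w₀h : w₀ ∼ (w₀ ∷ʳ h)
    w₀∼w₀h = absorb bound w₀ (∷ʳ-bounded w₀ h len) h h-fixed
    module E = Exchange (exchange bound w₀ (∷ʳ-bounded w₀ h len) g
      (subst (StrictlyFixesW (toℕ g)) (sym (window-cong (toℕ g) (⟦⟧-sound w₀∼w₀h))) strict))

  absorb (suc bound) w len g fixed with reverseView w
  ... | [] = ⊥-elim (ascending-unfixed (toℕ g) fixed)
  ... | w₀ ∶ _ ∶ʳ h with fixed⊎moved (toℕ h) ⟦ w₀ ⟧
  ...   | inj₂ h-moved = absorb-moved bound w₀ (∷ʳ-bounded w₀ h len) g h refl refl (adjacency _ _) h-moved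
                           (subst (Fixed (toℕ g)) (⟦⟧-∷ʳ w₀ h) fixed)
  ...   | inj₁ h-fixed = begin
      w₀ ∷ʳ h           ≈⟨ w₀∼w₀h ⟨
      w₀                ≈⟨ absorb bound w₀ (∷ʳ-bounded w₀ h len) g
                             (subst (FixesW (toℕ g)) (sym (window-cong (toℕ g) (⟦⟧-sound w₀∼w₀h))) fixed) ⟩
      w₀ ∷ʳ g           ≈⟨ ∼-congʳ [ g ] w₀∼w₀h ⟩
      (w₀ ∷ʳ h) ∷ʳ g    ∎
    where
    w₀∼w₀h : w₀ ∼ (w₀ ∷ʳ h)
    w₀∼w₀h = absorb bound w₀ (∷ʳ-bounded w₀ h len) h h-fixed

  exchange-moved bound w₀ len₀ g h g≡ h≡ (up k) moved strict =
    exchanged (E₂.prefix ++ g ∷ h ∷ [])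
      (exchange-via E₁.factor E₂.factor (∼sym (apply-braid E₂.prefix k g≡ h≡)))
      (pair-shorter w₀ E₁.prefix E₂.prefix g h E₂.shorter E₁.shorter) moved-end
    where
    t : Seq
    t = ⟦ w₀ ⟧
    module E₁ = Exchange (exchange bound w₀ len₀ g
      (subst (λ m → StrictlyFixed m t) (sym g≡)
             (up-before k t moved (strict⇒fixed (suc k) (sortAt (suc k) t) strict))))
    u : Seq
    u = ⟦ E₁.prefix ⟧
    t≗ : t ≗ sortAt k u
    t≗ = ⟦⟧-factor E₁.factor g≡
    u-moved : Moved (suc k) u
    u-moved = subst (λ m → Moved m u) g≡ E₁.moved
    module E₂ = Exchange (exchange bound E₁.prefix (<-trans E₁.shorter len₀) h
      (subst (λ m → StrictlyFixed m u) (sym h≡) (up-middle-strict k t u t≗ u-moved strict)))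
    moved-end : Moved (toℕ g) ⟦ E₂.prefix ++ g ∷ h ∷ [] ⟧
    moved-end = subst₂ Moved (sym g≡) (sym (⟦⟧-pair E₂.prefix g h g≡ h≡))
      (up-end k t u ⟦ E₂.prefix ⟧ t≗ (⟦⟧-factor E₂.factor h≡) u-moved
              (subst (λ m → Moved m ⟦ E₂.prefix ⟧) h≡ E₂.moved) moved strict)
  exchange-moved bound w₀ len₀ g h g≡ h≡ (down k) moved strict =
    exchanged (E₂.prefix ++ g ∷ h ∷ [])
      (exchange-via E₁.factor E₂.factor (apply-braid E₂.prefix k h≡ g≡))
      (pair-shorter w₀ E₁.prefix E₂.prefix g h E₂.shorter E₁.shorter) moved-end
    where
    t : Seq
    t = ⟦ w₀ ⟧
    module E₁ = Exchange (exchange bound w₀ len₀ g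
      (subst (λ m → StrictlyFixed m t) (sym g≡)
             (down-before k t moved (strict⇒fixed (suc (suc k)) (sortAt k t) strict))))
    u : Seq
    u = ⟦ E₁.prefix ⟧
    t≗ : t ≗ sortAt (suc k) u
    t≗ = ⟦⟧-factor E₁.factor g≡
    u-moved : Moved (suc (suc k)) u
    u-moved = subst (λ m → Moved m u) g≡ E₁.moved
    module E₂ = Exchange (exchange bound E₁.prefix (<-trans E₁.shorter len₀) h
      (subst (λ m → StrictlyFixed m u) (sym h≡) (down-middle-strict k t u t≗ u-moved strict)))
    moved-end : Moved (toℕ g) ⟦ E₂.prefix ++ g ∷ h ∷ [] ⟧
    moved-end = subst₂ Moved (sym g≡) (sym (⟦⟧-pair E₂.prefix g h g≡ h≡))
      (down-end k t u ⟦ E₂.prefix ⟧ t≗ (⟦⟧-factor E₂.factor h≡) u-moved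
                (subst (λ m → Moved m ⟦ E₂.prefix ⟧) h≡ E₂.moved) moved strict)
  exchange-moved bound w₀ len₀ g h g≡ h≡ one-zero moved strict = ⊥-elim (n≮0 strict)
  exchange-moved bound w₀ len₀ g h g≡ h≡ zero-one moved strict = ⊥-elim (zero-one-unfixed ⟦ w₀ ⟧ moved strict)
  exchange-moved bound w₀ len₀ g h refl h≡ same moved strict =
    exchanged w₀ (≡⇒∼ (cong (w₀ ∷ʳ_) (toℕ-injective h≡))) (∷ʳ-shorter w₀ h) moved
  exchange-moved bound w₀ len₀ g h refl refl (far d) moved strict =
    exchanged (E.prefix ∷ʳ h) factor shorter
      (subst (MovesW (toℕ g))
             (sym (trans (cong (window (toℕ g)) (⟦⟧-∷ʳ E.prefix h)) (window-far _ _ d _))) E.moved)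
    where
    module E = Exchange (exchange bound w₀ len₀ g
      (subst (StrictlyFixesW (toℕ g)) (window-far _ _ d _) strict))
    factor : (w₀ ∷ʳ h) ∼ ((E.prefix ∷ʳ h) ∷ʳ g)
    factor = begin
      w₀ ∷ʳ h                  ≈⟨ ∼-∷ʳ h E.factor ⟩
      E.prefix ++ g ∷ h ∷ []   ≈⟨ apply-rule E.prefix (commute g h d) ⟩
      E.prefix ++ h ∷ g ∷ []   ≡⟨ ++-assoc E.prefix [ h ] [ g ] ⟨
      (E.prefix ∷ʳ h) ∷ʳ g     ∎
    shorter : length (E.prefix ∷ʳ h) < length (w₀ ∷ʳ h)
    shorter = subst₂ _<_ (sym (length-∷ʳ E.prefix h)) (sym (length-∷ʳ w₀ h)) (s≤s E.shorter)

  absorb-moved bound w₀ len₀ g h g≡ h≡ (up k) moved fixed = absorb-via E.factor (begin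
    E.prefix ++ g ∷ h ∷ g ∷ []  ≈⟨ apply-braid E.prefix k g≡ h≡ ⟩
    E.prefix ++ h ∷ g ∷ h ∷ []  ≈⟨ absorb-letter (g ∷ h ∷ []) u∼uh ⟩
    E.prefix ++ g ∷ h ∷ []      ∎)
    where
    t : Seq
    t = ⟦ w₀ ⟧
    module E = Exchange (exchange bound w₀ len₀ g
      (subst (λ m → StrictlyFixed m t) (sym g≡) (up-before k t moved fixed)))
    u : Seq
    u = ⟦ E.prefix ⟧
    u∼uh : E.prefix ∼ (E.prefix ∷ʳ h)
    u∼uh = absorb bound E.prefix (<-trans E.shorter len₀) h (subst (λ m → Fixed m u) (sym h≡)
      (up-middle-fixed k t u (⟦⟧-factor E.factor g≡) (subst (λ m → Moved m u) g≡ E.moved) fixed))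
  absorb-moved bound w₀ len₀ g h g≡ h≡ (down k) moved fixed = absorb-via E.factor (begin
    E.prefix ++ g ∷ h ∷ g ∷ []  ≈⟨ apply-braid E.prefix k h≡ g≡ ⟨
    E.prefix ++ h ∷ g ∷ h ∷ []  ≈⟨ absorb-letter (g ∷ h ∷ []) u∼uh ⟩
    E.prefix ++ g ∷ h ∷ []      ∎)
    where
    t : Seq
    t = ⟦ w₀ ⟧
    module E = Exchange (exchange bound w₀ len₀ g
      (subst (λ m → StrictlyFixed m t) (sym g≡) (down-before k t moved fixed)))
    u : Seq
    u = ⟦ E.prefix ⟧
    u∼uh : E.prefix ∼ (E.prefix ∷ʳ h)
    u∼uh = absorb bound E.prefix (<-trans E.shorter len₀) h (subst (λ m → Fixed m u) (sym h≡)
      (down-middle-fixed k t u (⟦⟧-factor E.factor g≡) (subst (λ m → Moved m u) g≡ E.moved) fixed))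
  absorb-moved bound w₀ len₀ g h g≡ h≡ one-zero moved fixed = absorb-via E.factor (begin
    E.prefix ++ g ∷ h ∷ g ∷ []      ≈⟨ absorb-letter (g ∷ h ∷ g ∷ []) u∼uh ⟨
    E.prefix ++ h ∷ g ∷ h ∷ g ∷ []  ≈⟨ apply-rule E.prefix (zeroʳ h g h≡ g≡) ⟨
    E.prefix ++ h ∷ g ∷ h ∷ []      ≈⟨ absorb-letter (g ∷ h ∷ []) u∼uh ⟩
    E.prefix ++ g ∷ h ∷ []          ∎)
    where
    t : Seq
    t = ⟦ w₀ ⟧
    module E = Exchange (exchange bound w₀ len₀ g
      (subst (λ m → StrictlyFixed m t) (sym g≡) (one-zero-before t moved fixed)))
    u : Seq
    u = ⟦ E.prefix ⟧
    u∼uh : E.prefix ∼ (E.prefix ∷ʳ h)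
    u∼uh = absorb bound E.prefix (<-trans E.shorter len₀) h (subst (λ m → Fixed m u) (sym h≡)
      (one-zero-middle t u (⟦⟧-factor E.factor g≡) (subst (λ m → Moved m u) g≡ E.moved) fixed))
  absorb-moved bound w₀ len₀ g h g≡ h≡ zero-one moved fixed = ⊥-elim (zero-one-unfixed ⟦ w₀ ⟧ moved fixed)
  absorb-moved bound w₀ len₀ g h refl h≡ same moved fixed =
    subst (λ x → (w₀ ∷ʳ h) ∼ ((w₀ ∷ʳ h) ∷ʳ x)) (toℕ-injective h≡)
      (∼trans (∼sym (apply-rule w₀ (idem h))) (≡⇒∼ (sym (++-assoc w₀ [ h ] [ h ]))))
  absorb-moved bound w₀ len₀ g h refl refl (far d) moved fixed = begin
    w₀ ∷ʳ h            ≈⟨ ∼-∷ʳ h (absorb bound w₀ len₀ g (subst (FixesW (toℕ g)) (window-far _ _ d _) fixed)) ⟩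
    w₀ ++ g ∷ h ∷ []   ≈⟨ apply-rule w₀ (commute g h d) ⟩
    w₀ ++ h ∷ g ∷ []   ≡⟨ ++-assoc w₀ [ h ] [ g ] ⟨
    (w₀ ∷ʳ h) ∷ʳ g     ∎

  fixed⇒absorbs : ∀ (w : Word n) g → Fixed (toℕ g) ⟦ w ⟧ → w ∼ (w ∷ʳ g)
  fixed⇒absorbs w = absorb (suc (length w)) w ≤-refl

  ⟦⟧-extends : ∀ (x d : Word n) → ⟦ x ⟧ ≼[ n ] ⟦ x ++ d ⟧
  ⟦⟧-extends x d = subst (⟦ x ⟧ ≼[ n ]_) (sym (run-++ x d ascending)) (run-extensive d ⟦ x ⟧)

  ⟦⟧-prefix : ∀ (p w : Word n) → ⟦ w ⟧ ≼[ n ] ⟦ p ++ w ⟧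
  ⟦⟧-prefix p w =
    subst (⟦ w ⟧ ≼[ n ]_) (sym (run-++ p w ascending)) (run-monotone w (run-extensive p ascending))

  stable⇒absorbs : ∀ (x : Word n) g → ⟦ x ∷ʳ g ⟧ ≼[ n ] ⟦ x ⟧ → x ∼ (x ∷ʳ g)
  stable⇒absorbs x g xg≼x = fixed⇒absorbs x g (fixed⇐gen-trivial (toℕ g) ⟦ x ⟧ n (toℕ<n g) λ p p<n →
    trans (≼-antisym n (⟦⟧-extends x [ g ]) xg≼x p p<n) (cong-app (⟦⟧-∷ʳ x g) p))

  absorb-suffix : ∀ (d x : Word n) → ⟦ x ++ d ⟧ ≼[ n ] ⟦ x ⟧ → x ∼ (x ++ d)
  absorb-suffix []      x _      = ≡⇒∼ (sym (++-identityʳ x))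
  absorb-suffix (g ∷ d) x xd≼x = begin
    x              ≈⟨ stable⇒absorbs x g xg≼x ⟩
    x ∷ʳ g         ≈⟨ absorb-suffix d (x ∷ʳ g) xgd≼xg ⟩
    (x ∷ʳ g) ++ d  ≡⟨ ++-assoc x [ g ] d ⟩
    x ++ g ∷ d     ∎
    where
    xg≼x : ⟦ x ∷ʳ g ⟧ ≼[ n ] ⟦ x ⟧
    xg≼x = ≼-trans n (subst (⟦ x ∷ʳ g ⟧ ≼[ n ]_) (cong ⟦_⟧ (++-assoc x [ g ] d)) (⟦⟧-extends (x ∷ʳ g) d))
                     xd≼x
    xgd≼xg : ⟦ (x ∷ʳ g) ++ d ⟧ ≼[ n ] ⟦ x ∷ʳ g ⟧
    xgd≼xg = ≼-trans n (subst (_≼[ n ] ⟦ x ⟧) (cong ⟦_⟧ (sym (++-assoc x [ g ] d))) xd≼x)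
                       (⟦⟧-extends x [ g ])

  absorb-right : ∀ (p x d b : Word n) → x ∼ ((p ++ x) ++ (d ++ b)) → x ∼ (x ++ d)
  absorb-right p x d b x∼pxdb = absorb-suffix d x (≼-trans n (⟦⟧-extends (x ++ d) b) xdb≼x)
    where
    regroup : p ++ ((x ++ d) ++ b) ≡ (p ++ x) ++ (d ++ b)
    regroup = trans (cong (p ++_) (++-assoc x d b)) (sym (++-assoc p x (d ++ b)))
    xdb≼x : ⟦ (x ++ d) ++ b ⟧ ≼[ n ] ⟦ x ⟧
    xdb≼x = ≼-resp-≗ n (λ _ → refl) (λ q → trans (cong-app (cong ⟦_⟧ regroup) q) (sym (⟦⟧-sound x∼pxdb q)))
                       (⟦⟧-prefix p ((x ++ d) ++ b))

  reverse-rule : ∀ {l r} → Rule n l r → reverse l ∼ reverse r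
  reverse-rule (idem i)          = step [] [] (idem i)
  reverse-rule (braid i j le eq) = step [] [] (braid i j le eq)
  reverse-rule (zeroˡ a b ea eb) = ∼sym (step [] [] (zeroʳ a b ea eb))
  reverse-rule (zeroʳ a b ea eb) = ∼sym (step [] [] (zeroˡ a b ea eb))
  reverse-rule (commute i j d)   = step [] [] (commute j i (subst (2 ≤_) (∣-∣-comm (toℕ i) (toℕ j)) d))

  reverse-∼ : {x y : Word n} → x ∼ y → reverse x ∼ reverse y
  reverse-∼ (step u v {l} {r} ρ) = begin
    reverse (u ++ l ++ v)                   ≡⟨ reverse-three l ⟩
    reverse v ++ (reverse l ++ reverse u)   ≈⟨ ∼-congˡ (reverse v) (∼-congʳ (reverse u) (reverse-rule ρ)) ⟩
    reverse v ++ (reverse r ++ reverse u)   ≡⟨ reverse-three r ⟨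
    reverse (u ++ r ++ v)                   ∎
    where
    reverse-three : ∀ z → reverse (u ++ z ++ v) ≡ reverse v ++ (reverse z ++ reverse u)
    reverse-three z = trans (reverse-++ u (z ++ v))
      (trans (cong (_++ reverse u) (reverse-++ z v)) (++-assoc (reverse v) (reverse z) (reverse u)))
  reverse-∼ ∼refl          = ∼refl
  reverse-∼ (∼sym x∼y)     = ∼sym (reverse-∼ x∼y)
  reverse-∼ (∼trans x∼y y∼z) = ∼trans (reverse-∼ x∼y) (reverse-∼ y∼z)

  absorb-left : ∀ (a c x q : Word n) → x ∼ (((a ++ c) ++ x) ++ q) → x ∼ (c ++ x)
  absorb-left a c x q x∼acxq = begin
    x                          ≡⟨ reverse-involutive x ⟨
    reverse (reverse x)        ≈⟨ reverse-∼ (absorb-right (reverse q) (reverse x) (reverse c) (reverse a)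
                                                            rev-cycle) ⟩
    reverse (reverse x ++ reverse c)  ≡⟨ cong reverse (reverse-++ c x) ⟨
    reverse (reverse (c ++ x)) ≡⟨ reverse-involutive (c ++ x) ⟩
    c ++ x                     ∎
    where
    rev-cycle : reverse x ∼ ((reverse q ++ reverse x) ++ (reverse c ++ reverse a))
    rev-cycle = begin
      reverse x                                              ≈⟨ reverse-∼ x∼acxq ⟩
      reverse (((a ++ c) ++ x) ++ q)                         ≡⟨ reverse-++ ((a ++ c) ++ x) q ⟩
      reverse q ++ reverse ((a ++ c) ++ x)                   ≡⟨ cong (reverse q ++_) (reverse-++ (a ++ c) x) ⟩
      reverse q ++ (reverse x ++ reverse (a ++ c))           ≡⟨ cong ((reverse q ++_) ∘ (reverse x ++_))
                                                                       (reverse-++ a c) ⟩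
      reverse q ++ (reverse x ++ (reverse c ++ reverse a))   ≡⟨ ++-assoc (reverse q) (reverse x) _ ⟨
      (reverse q ++ reverse x) ++ (reverse c ++ reverse a)   ∎

  R⁰-J-trivial : J-trivial (R⁰ n)
  R⁰-J-trivial x y ((a , b , x∼ayb) , (c , d , y∼cxd)) = begin
    x               ≈⟨ absorb-right (a ++ c) x d b cycle ⟩
    x ++ d          ≈⟨ ∼-congʳ d (absorb-left a c x (d ++ b) cycle) ⟩
    (c ++ x) ++ d   ≈⟨ y∼cxd ⟨
    y               ∎
    where
    cycle : x ∼ (((a ++ c) ++ x) ++ (d ++ b))
    cycle = begin
      x                             ≈⟨ x∼ayb ⟩
      (a ++ y) ++ b                 ≈⟨ ∼-congʳ b (∼-congˡ a y∼cxd) ⟩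
      (a ++ ((c ++ x) ++ d)) ++ b   ≡⟨ ++-assoc a ((c ++ x) ++ d) b ⟩
      a ++ (((c ++ x) ++ d) ++ b)   ≡⟨ cong (a ++_) (++-assoc (c ++ x) d b) ⟩
      a ++ ((c ++ x) ++ (d ++ b))   ≡⟨ ++-assoc a (c ++ x) (d ++ b) ⟨
      (a ++ (c ++ x)) ++ (d ++ b)   ≡⟨ cong (_++ (d ++ b)) (++-assoc a c x) ⟨
      ((a ++ c) ++ x) ++ (d ++ b)   ∎

module _ {c ℓ} (M : Monoid c ℓ) where
  open Monoid M using (ε; _∙_; ∙-congʳ; identityˡ; identityʳ) renaming (trans to ≈-trans; sym to ≈-sym)

  J-trivial⇒R-trivial : J-trivial M → R-trivial M
  J-trivial⇒R-trivial J x y ((u , x≈yu) , (v , y≈xv)) = J x y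
    ( (ε , u , ≈-trans x≈yu (∙-congʳ (≈-sym (identityˡ y))))
    , (ε , v , ≈-trans y≈xv (∙-congʳ (≈-sym (identityˡ x)))))

  J-trivial⇒L-trivial : J-trivial M → L-trivial M
  J-trivial⇒L-trivial J x y ((u , x≈uy) , (v , y≈vx)) = J x y
    ( (u , ε , ≈-trans x≈uy (≈-sym (identityʳ (u ∙ y))))
    , (v , ε , ≈-trans y≈vx (≈-sym (identityʳ (v ∙ x)))))

corollary4p17 : (n : ℕ) →
    R-trivial (R⁰ n) × L-trivial (R⁰ n) × J-trivial (R⁰ n)
corollary4p17 n =
  J-trivial⇒R-trivial (R⁰ n) R⁰-J-trivial , J-trivial⇒L-trivial (R⁰ n) R⁰-J-trivial , R⁰-J-trivial
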